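{- Let $G=(V,E)$ be a simple graph and $v\in V$. Then $$P(\mathcal{H}_{\bullet G},\lambda)=(\lambda-1)\,P(\mathcal{H}_{\bullet(G-\{v\})},\lambda)+(\lambda-1)^{d(v)}\,P(\mathcal{H}_{\bullet(G-N[v])},\lambda),$$ where $d(v)$ is the degree of $v$, $N[v]$ is the set consisting of $v$ and its neighbours, and $G-S$ denotes the subgraph induced by $V\setminus S$.
   Context: A hypergraph $\mathcal{H}=(\mathcal{V},\mathcal{E})$ has a finite vertex set and a set of edges, each a subset of $\mathcal{V}$ of size at least 1. For positive integer $\lambda$, a weak proper $\lambda$-colouring is a map $\phi:\mathcal{V}\to\{1,\dots,\lambda\}$ with $|\{\phi(v):v\in e\}|>1$ for each edge $e$; $P(\mathcal{H},\lambda)$ is the polynomial counting them. For a simple graph $G=(V,E)$ (possibly with no vertices), $\mathcal{H}_{\bullet G}$ is the hypergraph with vertex set $V\cup\{w\}$ ($w\notin V$ new) and edge set $\{\{u,v,w\}:uv\in E\}$. -}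

module Defs where

open import Data.Nat using (ℕ; zero; suc)
open import Data.Bool using (Bool; true; false; not; _∧_)
open import Data.Fin using (Fin; zero; suc; _≟_)
open import Data.List using (List; []; _∷_; [_]; map; concatMap; filter; filterᵇ; length; allFin)
open import Data.Bool.ListAction using (any; all)
open import Data.List.Relation.Unary.Any using (Any)
open import Data.Vec using (Vec; []; _∷_; lookup)
open import Relation.Nullary.Decidable using (⌊_⌋)
open import Relation.Binary.PropositionalEquality using (_≡_)

record SimpleGraph (n : ℕ) : Set where
  field
    adj   : Fin n → Fin n → Bool
    sym   : ∀ i j → adj i j ≡ adj j i
    irref : ∀ i → adj i i ≡ false
open SimpleGraph public

lookupL : ∀ {n} (ws : List (Fin n)) → Fin (length ws) → Fin n
lookupL (w ∷ ws) zero    = w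
lookupL (w ∷ ws) (suc i) = lookupL ws i

induce : ∀ {n} → SimpleGraph n → (ws : List (Fin n)) → SimpleGraph (length ws)
induce G ws = record
  { adj   = λ i j → adj G (lookupL ws i) (lookupL ws j)
  ; sym   = λ i j → sym G (lookupL ws i) (lookupL ws j)
  ; irref = λ i → irref G (lookupL ws i) }

_==_ : ∀ {n} → Fin n → Fin n → Bool
i == j = ⌊ i ≟ j ⌋

_minus_ : {n : ℕ} (G : SimpleGraph n) (inS : Fin n → Bool) →
          SimpleGraph (length (filterᵇ (λ u → not (inS u)) (allFin n)))
_minus_ {n} G inS = induce G (filterᵇ (λ u → not (inS u)) (allFin n))

single : ∀ {n} → Fin n → Fin n → Bool
single v u = u == v

closedNbhd : ∀ {n} → SimpleGraph n → Fin n → Fin n → Bool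
closedNbhd G v u = (u == v) Data.Bool.∨ adj G v u

degree : {n : ℕ} → SimpleGraph n → Fin n → ℕ
degree {n} G v = length (filterᵇ (adj G v) (allFin n))

-- Hypergraphs on vertex set Fin m; an edge is a (nonempty) list of
-- vertices, read as the set of its entries.

record Hypergraph : Set where
  field
    m     : ℕ
    edges : List (List (Fin m))
open Hypergraph public

-- all maps Fin m → Fin λ, as vectors (each exactly once)
allMaps : (λ′ m : ℕ) → List (Vec (Fin λ′) m)
allMaps λ′ zero    = [ [] ]
allMaps λ′ (suc m) = concatMap (λ c → map (c ∷_) (allMaps λ′ m)) (allFin λ′)

edgeOK : ∀ {m λ′} → (Fin m → Fin λ′) → List (Fin m) → Bool
edgeOK φ e = any (λ x → any (λ y → not (φ x == φ y)) e) e

weakProper : ∀ {λ′} (H : Hypergraph) → (Fin (m H) → Fin λ′) → Bool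
weakProper H φ = all (edgeOK φ) (edges H)

P : Hypergraph → ℕ → ℕ
P H λ′ = length (filterᵇ (λ φ → weakProper H (lookup φ)) (allMaps λ′ (m H)))

-- H_{•G}: vertex set V ∪ {w} with w = zero and u ∈ V embedded as suc u;
-- edges {u, v, w} for every adjacent pair (listed for both orders,
-- which does not change the edge set).

bulletH : ∀ {n} → SimpleGraph n → Hypergraph
bulletH {n} G = record
  { m     = suc n
  ; edges = concatMap (λ u → map (λ v → suc u ∷ suc v ∷ zero ∷ [])
                                 (filterᵇ (adj G u) (allFin n)))
                      (allFin n) }

-- Fix the colour c of the apex w.  An edge {u, v, w} of H_{•G} is then
-- monochromatic exactly when u and v both receive c, so the colourings
-- of H_{•G} with φ w = c correspond to an independent set S of G (the
-- vertices coloured c) together with one of λ - 1 colours on each vertex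
-- outside S.  Hence P(H_{•G}, λ) = λ · I_G(λ - 1) where
-- I_G(k) = Σ_{S independent} k ^ |V ∖ S|, and the claim is the vertex
-- recursion of I_G: either v ∉ S, or v ∈ S, which excludes its d(v)
-- neighbours from S (each then contributes a factor k) and leaves an
-- independent set of G - N[v].
module Submission where

open import Defs hiding (sym)
open import Data.Bool using (Bool; true; false; not; _∧_; _∨_; if_then_else_; T)
open import Data.Bool.ListAction using (all; and)
open import Data.Bool.Properties using (∨-zeroʳ; ∨-identityʳ; ∧-zeroʳ; ∨-comm; ∧-assoc; ∧-idem)
open import Data.Fin using (Fin; zero; suc; _≟_)
open import Data.List using (List; []; _∷_; map; concatMap; filterᵇ; length; allFin; _++_)
open import Data.List.Properties
  using (map-cong; map-∘; map-tabulate; length-tabulate; length-++; filter-++)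
open import Data.Nat using (ℕ; zero; suc; _+_; _*_; _∸_; _^_; _≤_)
open import Data.Nat.ListAction using (sum)
open import Data.Nat.Properties using (suc-injective; +-comm; +-identityʳ; *-assoc; +-commutativeSemigroup)
open import Algebra.Properties.CommutativeSemigroup +-commutativeSemigroup using (x∙yz≈y∙xz)
open import Data.Nat.Tactic.RingSolver using (solve-∀)
open import Data.Unit using (tt)
open import Data.Vec using (Vec; []; _∷_; lookup)
open import Function using (_∘_; id; _on_)
open import Relation.Binary.PropositionalEquality
open import Relation.Nullary.Decidable using (toWitness; yes; no; T?)

private variable
  A A′ : Set

not-∨ : ∀ a b → not a ∧ not b ≡ not (a ∨ b)
not-∨ true  b = refl
not-∨ false b = refl

∨-swapʳ : ∀ a b c → (a ∨ b) ∨ c ≡ (a ∨ c) ∨ b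
∨-swapʳ true  b c = refl
∨-swapʳ false b c = ∨-comm b c

not-∧-∨ : ∀ s b a → not (s ∧ (b ∨ a)) ≡ not (s ∧ b) ∧ not (s ∧ a)
not-∧-∨ false b     a = refl
not-∧-∨ true  true  a = refl
not-∧-∨ true  false a = refl

not-∨-not : ∀ a s t → (not a ∨ not (s ∧ t)) ≡ not (s ∧ t ∧ a)
not-∨-not true  true  true  = refl
not-∨-not true  true  false = refl
not-∨-not true  false t     = refl
not-∨-not false true  true  = refl
not-∨-not false true  false = refl
not-∨-not false false t     = refl

filterᵇ-cong : {p q : A → Bool} → (∀ x → p x ≡ q x) → (xs : List A) → filterᵇ p xs ≡ filterᵇ q xs
filterᵇ-cong p≗q [] = refl
filterᵇ-cong {p = p} {q} p≗q (x ∷ xs) with p x | q x | p≗q x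
... | true  | true  | refl = cong (x ∷_) (filterᵇ-cong p≗q xs)
... | false | false | refl = filterᵇ-cong p≗q xs

filterᵇ-filterᵇ : (p q : A → Bool) (xs : List A) →
                  filterᵇ p (filterᵇ q xs) ≡ filterᵇ (λ x → q x ∧ p x) xs
filterᵇ-filterᵇ p q [] = refl
filterᵇ-filterᵇ p q (x ∷ xs) with q x
... | false = filterᵇ-filterᵇ p q xs
... | true with p x
...   | true  = cong (x ∷_) (filterᵇ-filterᵇ p q xs)
...   | false = filterᵇ-filterᵇ p q xs

filterᵇ-false : (xs : List A) → filterᵇ (λ _ → false) xs ≡ []
filterᵇ-false [] = refl
filterᵇ-false (x ∷ xs) = filterᵇ-false xs

filterᵇ-reject-none : (p : A → Bool) (xs : List A) →
                      length (filterᵇ p xs) ≡ 0 → filterᵇ (not ∘ p) xs ≡ xs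
filterᵇ-reject-none p [] _ = refl
filterᵇ-reject-none p (x ∷ xs) none with p x
... | false = cong (x ∷_) (filterᵇ-reject-none p xs none)

length-filterᵇ-map : (p : A′ → Bool) (f : A → A′) (xs : List A) →
                     length (filterᵇ p (map f xs)) ≡ length (filterᵇ (p ∘ f) xs)
length-filterᵇ-map p f [] = refl
length-filterᵇ-map p f (x ∷ xs) with p (f x)
... | true  = cong suc (length-filterᵇ-map p f xs)
... | false = length-filterᵇ-map p f xs

length-filterᵇ-concatMap : (p : A′ → Bool) (g : A → List A′) (xs : List A) →
  length (filterᵇ p (concatMap g xs)) ≡ sum (map (λ x → length (filterᵇ p (g x))) xs)
length-filterᵇ-concatMap p g [] = refl
length-filterᵇ-concatMap p g (x ∷ xs) = begin
  length (filterᵇ p (g x ++ concatMap g xs))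
    ≡⟨ cong length (filter-++ (T? ∘ p) (g x) (concatMap g xs)) ⟩
  length (filterᵇ p (g x) ++ filterᵇ p (concatMap g xs))
    ≡⟨ length-++ (filterᵇ p (g x)) ⟩
  length (filterᵇ p (g x)) + length (filterᵇ p (concatMap g xs))
    ≡⟨ cong (length (filterᵇ p (g x)) +_) (length-filterᵇ-concatMap p g xs) ⟩
  sum (map (λ x → length (filterᵇ p (g x))) (x ∷ xs)) ∎
  where open ≡-Reasoning

all-cong : {p q : A → Bool} → (∀ x → p x ≡ q x) → (xs : List A) → all p xs ≡ all q xs
all-cong p≗q xs = cong and (map-cong p≗q xs)

all-true : (xs : List A) → all (λ _ → true) xs ≡ true
all-true [] = refl
all-true (x ∷ xs) = all-true xs

all-∧ : (p q : A → Bool) (xs : List A) → all (λ x → p x ∧ q x) xs ≡ all p xs ∧ all q xs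
all-∧ p q [] = refl
all-∧ p q (x ∷ xs) with p x | q x
... | true  | true  = all-∧ p q xs
... | true  | false = sym (∧-zeroʳ (all p xs))
... | false | _     = refl

all-map : (p : A′ → Bool) (f : A → A′) (xs : List A) → all p (map f xs) ≡ all (p ∘ f) xs
all-map p f xs = cong and (sym (map-∘ xs))

all-++ : (p : A → Bool) (xs ys : List A) → all p (xs ++ ys) ≡ all p xs ∧ all p ys
all-++ p [] ys = refl
all-++ p (x ∷ xs) ys = trans (cong (p x ∧_) (all-++ p xs ys)) (sym (∧-assoc (p x) _ _))

all-concatMap : (p : A′ → Bool) (g : A → List A′) (xs : List A) →
                all p (concatMap g xs) ≡ all (λ x → all p (g x)) xs
all-concatMap p g [] = refl
all-concatMap p g (x ∷ xs) = trans (all-++ p (g x) _) (cong (all p (g x) ∧_) (all-concatMap p g xs))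

all-filterᵇ : (p q : A → Bool) (xs : List A) → all p (filterᵇ q xs) ≡ all (λ x → not (q x) ∨ p x) xs
all-filterᵇ p q [] = refl
all-filterᵇ p q (x ∷ xs) with q x
... | true  = cong (p x ∧_) (all-filterᵇ p q xs)
... | false = all-filterᵇ p q xs

==-suc : ∀ {n} (i j : Fin n) → (suc i == suc j) ≡ (i == j)
==-suc i j with i ≟ j
... | yes _ = refl
... | no _  = refl

==-refl : ∀ {n} (i : Fin n) → (i == i) ≡ true
==-refl zero = refl
==-refl (suc i) = trans (==-suc i i) (==-refl i)

==-sound : ∀ {n} {i j : Fin n} → (i == j) ≡ true → i ≡ j
==-sound i==j = toWitness (subst T (sym i==j) tt)

==-sym : ∀ {n} (i j : Fin n) → (i == j) ≡ (j == i)
==-sym zero zero = refl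
==-sym zero (suc j) = refl
==-sym (suc i) zero = refl
==-sym (suc i) (suc j) = trans (==-suc i j) (trans (==-sym i j) (sym (==-suc j i)))

allFin-suc : ∀ n → allFin (suc n) ≡ zero ∷ map suc (allFin n)
allFin-suc n = cong (zero ∷_) (sym (map-tabulate id suc))

length-filterᵇ-== : ∀ {n} (v : Fin n) → length (filterᵇ (_== v) (allFin n)) ≡ 1
length-filterᵇ-== {suc n} v = trans (cong (length ∘ filterᵇ (_== v)) (allFin-suc n)) (count v)
  where
  count : (v : Fin (suc n)) → length (filterᵇ (_== v) (zero ∷ map suc (allFin n))) ≡ 1
  count zero = cong suc (trans (length-filterᵇ-map (_== zero) suc (allFin n))
                               (cong length (filterᵇ-false (allFin n))))
  count (suc v) = trans (length-filterᵇ-map (_== suc v) suc (allFin n))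
    (trans (cong length (filterᵇ-cong (λ i → ==-suc i v) (allFin n))) (length-filterᵇ-== v))

sum-const : (y : ℕ) (xs : List A) → sum (map (λ _ → y) xs) ≡ length xs * y
sum-const y [] = refl
sum-const y (x ∷ xs) = cong (y +_) (sum-const y xs)

sum-allFin-const : (y l : ℕ) → sum (map (λ _ → y) (allFin l)) ≡ l * y
sum-allFin-const y l = trans (sum-const y (allFin l)) (cong (_* y) (length-tabulate {n = l} id))

sum-allFin-suc : ∀ {l} (f : Fin (suc l) → ℕ) → sum (map f (allFin (suc l))) ≡ f zero + sum (map (f ∘ suc) (allFin l))
sum-allFin-suc {l} f =
  trans (cong (sum ∘ map f) (allFin-suc l)) (cong (λ fs → f zero + sum fs) (sym (map-∘ (allFin l))))

sum-allFin-indicator : ∀ {l} (c : Fin l) (a y : ℕ) →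
                       sum (map (λ d → if d == c then a else y) (allFin l)) ≡ a + (l ∸ 1) * y
sum-allFin-indicator {suc l} zero a y =
  trans (sum-allFin-suc {l} (λ d → if d == zero then a else y)) (cong (a +_) (sum-allFin-const y l))
sum-allFin-indicator {suc (suc l)} (suc c) a y = begin
  sum (map (λ d → if d == suc c then a else y) (allFin (suc (suc l))))
    ≡⟨ sum-allFin-suc {suc l} (λ d → if d == suc c then a else y) ⟩
  y + sum (map (λ d → if suc d == suc c then a else y) (allFin (suc l)))
    ≡⟨ cong (λ s → y + sum s) (map-cong (λ d → cong (if_then a else y) (==-suc d c)) (allFin (suc l))) ⟩
  y + sum (map (λ d → if d == c then a else y) (allFin (suc l)))
    ≡⟨ cong (y +_) (sum-allFin-indicator c a y) ⟩
  y + (a + l * y)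
    ≡⟨ x∙yz≈y∙xz y a (l * y) ⟩
  a + suc l * y ∎
  where open ≡-Reasoning

-- Weighted independent sets

private
  factor₀ : ∀ k p y → k * (p * y) + 0 ≡ p * (k * y + 0)
  factor₀ = solve-∀
  factor : ∀ k p y z → k * (p * y) + p * z ≡ p * (k * y + z)
  factor = solve-∀
  interchange₀ : ∀ k a c → k * (k * a + c) + 0 ≡ k * (k * a + 0) + (k * c + 0)
  interchange₀ = solve-∀
  interchange : ∀ k a b c d → k * (k * a + c) + (k * b + d) ≡ k * (k * a + b) + (k * c + d)
  interchange = solve-∀

module _ (k : ℕ) where

  -- For xs without repetitions: the sum of k ^ |xs ∖ S| over the sets
  -- S ⊆ xs that are independent in adj and disjoint from B.
  indepCount : (A → A → Bool) → List A → (A → Bool) → ℕ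
  indepCount adj [] B = 1
  indepCount adj (x ∷ xs) B =
    k * indepCount adj xs B + (if B x then 0 else indepCount adj xs (λ a → B a ∨ adj x a))

  indepCount-cong : (adj : A → A → Bool) (xs : List A) {B C : A → Bool} →
                    (∀ a → B a ≡ C a) → indepCount adj xs B ≡ indepCount adj xs C
  indepCount-cong adj [] B≗C = refl
  indepCount-cong adj (x ∷ xs) {C = C} B≗C rewrite B≗C x =
    cong₂ (λ s t → k * s + (if C x then 0 else t))
          (indepCount-cong adj xs B≗C) (indepCount-cong adj xs (λ a → cong (_∨ adj x a) (B≗C a)))

  indepCount-map : (adj : A′ → A′ → Bool) (f : A → A′) (xs : List A) (B : A′ → Bool) →
                   indepCount adj (map f xs) B ≡ indepCount (adj on f) xs (B ∘ f)
  indepCount-map adj f [] B = refl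
  indepCount-map adj f (x ∷ xs) B =
    cong₂ (λ s t → k * s + (if B (f x) then 0 else t))
          (indepCount-map adj f xs B) (indepCount-map adj f xs (λ a → B a ∨ adj (f x) a))

  -- A blocked vertex never enters S, so it only contributes its factor k.
  indepCount-blocked : (adj : A → A → Bool) (xs : List A) (B C : A → Bool) →
    indepCount adj xs (λ a → B a ∨ C a) ≡ k ^ length (filterᵇ C xs) * indepCount adj (filterᵇ (not ∘ C) xs) B
  indepCount-blocked adj [] B C = refl
  indepCount-blocked adj (x ∷ xs) B C with C x
  ... | true rewrite ∨-zeroʳ (B x) | indepCount-blocked adj xs B C =
    trans (+-identityʳ _) (sym (*-assoc k _ _))
  ... | false rewrite ∨-identityʳ (B x) | indepCount-blocked adj xs B C
                    | indepCount-cong adj xs (λ a → ∨-swapʳ (B a) (C a) (adj x a))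
                    | indepCount-blocked adj xs (λ a → B a ∨ adj x a) C
    with B x
  ...   | true  = factor₀ k (k ^ length (filterᵇ C xs)) _
  ...   | false = factor k (k ^ length (filterᵇ C xs)) _ _

  indepCount-swap : (adj : A → A → Bool) (x y : A) (xs : List A) (B : A → Bool) → adj x y ≡ adj y x →
                    indepCount adj (x ∷ y ∷ xs) B ≡ indepCount adj (y ∷ x ∷ xs) B
  indepCount-swap adj x y xs B xy≡yx
    rewrite xy≡yx | indepCount-cong adj xs (λ a → ∨-swapʳ (B a) (adj x a) (adj y a))
    with B x | B y
  ... | true  | true  = refl
  ... | true  | false = interchange₀ k _ _
  ... | false | true  = sym (interchange₀ k _ _)
  ... | false | false = interchange k _ _ _ _

  indepCount-extract : ∀ {n} (adj : Fin n → Fin n → Bool) → (∀ a b → adj a b ≡ adj b a) →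
    (v : Fin n) (xs : List (Fin n)) → length (filterᵇ (_== v) xs) ≡ 1 → (B : Fin n → Bool) →
    indepCount adj xs B ≡ indepCount adj (v ∷ filterᵇ (λ u → not (u == v)) xs) B
  indepCount-extract {n} adj adj-sym v (x ∷ xs) once B with x == v in x==v
  ... | true with refl ← ==-sound x==v
    rewrite filterᵇ-reject-none (_== v) xs (suc-injective once) = refl
  ... | false = begin
    indepCount adj (x ∷ xs) B
      ≡⟨ cong₂ (λ s t → k * s + (if B x then 0 else t))
               (indepCount-extract adj adj-sym v xs once B)
               (indepCount-extract adj adj-sym v xs once (λ a → B a ∨ adj x a)) ⟩
    indepCount adj (x ∷ v ∷ rest) B
      ≡⟨ indepCount-swap adj x v rest B (adj-sym x v) ⟩
    indepCount adj (v ∷ x ∷ rest) B ∎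
    where
    open ≡-Reasoning
    rest : List (Fin n)
    rest = filterᵇ (λ u → not (u == v)) xs

  indepCount-allFin-suc : ∀ {n} (adj : Fin (suc n) → Fin (suc n) → Bool) (B : Fin (suc n) → Bool) →
    indepCount adj (allFin (suc n)) B
      ≡ k * indepCount (adj on suc) (allFin n) (B ∘ suc)
        + (if B zero then 0 else indepCount (adj on suc) (allFin n) (λ a → B (suc a) ∨ adj zero (suc a)))
  indepCount-allFin-suc {n} adj B =
    trans (cong (λ xs → indepCount adj xs B) (allFin-suc n))
          (cong₂ (λ s t → k * s + (if B zero then 0 else t))
                 (indepCount-map adj suc (allFin n) B)
                 (indepCount-map adj suc (allFin n) (λ a → B a ∨ adj zero a)))

independentᵇ : (A → A → Bool) → (A → Bool) → List A → Bool
independentᵇ adj S xs = all (λ u → all (λ w → not (S u ∧ S w ∧ adj u w)) xs) xs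

disjointᵇ : (A → Bool) → (A → Bool) → List A → Bool
disjointᵇ S B xs = all (λ u → not (S u ∧ B u)) xs

indepAvoiding : (A → A → Bool) → (S B : A → Bool) → List A → Bool
indepAvoiding adj S B xs = disjointᵇ S B xs ∧ independentᵇ adj S xs

independentᵇ-∷ : {A : Set} (adj : A → A → Bool) (S : A → Bool) (x : A) (xs : List A) →
  (∀ a b → adj a b ≡ adj b a) → adj x x ≡ false →
  independentᵇ adj S (x ∷ xs) ≡ all (λ w → not (S x ∧ S w ∧ adj x w)) xs ∧ independentᵇ adj S xs
independentᵇ-∷ {A} adj S x xs adj-sym irr = begin
  (h x x ∧ N) ∧ all (λ u → h u x ∧ all (h u) xs) xs
    ≡⟨ cong₂ (λ b M → (b ∧ N) ∧ M) loopless (all-cong (λ u → cong (_∧ all (h u) xs) (h-sym u)) xs) ⟩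
  N ∧ all (λ u → h x u ∧ all (h u) xs) xs
    ≡⟨ cong (N ∧_) (all-∧ (h x) (λ u → all (h u) xs) xs) ⟩
  N ∧ (N ∧ independentᵇ adj S xs)
    ≡⟨ trans (sym (∧-assoc N N _)) (cong (_∧ independentᵇ adj S xs) (∧-idem N)) ⟩
  N ∧ independentᵇ adj S xs ∎
  where
  open ≡-Reasoning
  h : A → A → Bool
  h u w = not (S u ∧ S w ∧ adj u w)
  N : Bool
  N = all (h x) xs
  loopless : h x x ≡ true
  loopless rewrite irr with S x
  ... | true  = refl
  ... | false = refl
  h-sym : ∀ u → h u x ≡ h x u
  h-sym u rewrite adj-sym u x with S u | S x
  ... | true  | true  = refl
  ... | true  | false = refl
  ... | false | true  = refl
  ... | false | false = refl

indepAvoiding-∷ : (adj : A → A → Bool) (S B : A → Bool) (x : A) (xs : List A) →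
  (∀ a b → adj a b ≡ adj b a) → adj x x ≡ false →
  indepAvoiding adj S B (x ∷ xs)
    ≡ (if S x then not (B x) ∧ indepAvoiding adj S (λ a → B a ∨ adj x a) xs else indepAvoiding adj S B xs)
indepAvoiding-∷ adj S B x xs adj-sym irr rewrite independentᵇ-∷ adj S x xs adj-sym irr with S x
... | false = cong (λ t → disjointᵇ S B xs ∧ t ∧ independentᵇ adj S xs) (all-true xs)
... | true  = begin
  (not (B x) ∧ D) ∧ (N ∧ I)
    ≡⟨ trans (∧-assoc (not (B x)) D (N ∧ I)) (cong (not (B x) ∧_) (sym (∧-assoc D N I))) ⟩
  not (B x) ∧ ((D ∧ N) ∧ I)
    ≡⟨ cong (λ t → not (B x) ∧ t ∧ I) (sym (all-∧ (λ u → not (S u ∧ B u)) (λ u → not (S u ∧ adj x u)) xs)) ⟩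
  not (B x) ∧ (all (λ u → not (S u ∧ B u) ∧ not (S u ∧ adj x u)) xs ∧ I)
    ≡⟨ cong (λ t → not (B x) ∧ t ∧ I) (all-cong (λ u → sym (not-∧-∨ (S u) (B u) (adj x u))) xs) ⟩
  not (B x) ∧ (disjointᵇ S (λ a → B a ∨ adj x a) xs ∧ I) ∎
  where
  open ≡-Reasoning
  D N I : Bool
  D = disjointᵇ S B xs
  N = all (λ u → not (S u ∧ adj x u)) xs
  I = independentᵇ adj S xs

indepAvoiding-map : (adj : A′ → A′ → Bool) (S B : A′ → Bool) (f : A → A′) (xs : List A) →
                    indepAvoiding adj S B (map f xs) ≡ indepAvoiding (adj on f) (S ∘ f) (B ∘ f) xs
indepAvoiding-map adj S B f xs =
  cong₂ _∧_ (all-map _ f xs) (trans (all-map _ f xs) (all-cong (λ u → all-map _ f xs) xs))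

indepAvoiding-nothing : (adj : A → A → Bool) (S : A → Bool) (xs : List A) →
                        indepAvoiding adj S (λ _ → false) xs ≡ independentᵇ adj S xs
indepAvoiding-nothing adj S xs =
  cong (_∧ independentᵇ adj S xs) (trans (all-cong (λ u → cong not (∧-zeroʳ (S u))) xs) (all-true xs))

-- Counting colourings

colourClass : ∀ {l n} → Fin l → Vec (Fin l) n → Fin n → Bool
colourClass c ψ i = lookup ψ i == c

count-allMaps-suc : ∀ l n (p : Vec (Fin l) (suc n) → Bool) →
  length (filterᵇ p (allMaps l (suc n))) ≡ sum (map (λ d → length (filterᵇ (p ∘ (d ∷_)) (allMaps l n))) (allFin l))
count-allMaps-suc l n p =
  trans (length-filterᵇ-concatMap p (λ d → map (d ∷_) (allMaps l n)) (allFin l))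
        (cong sum (map-cong (λ d → length-filterᵇ-map p (d ∷_) (allMaps l n)) (allFin l)))

length-filterᵇ-if : (b b′ : Bool) (p q : A → Bool) (xs : List A) →
  length (filterᵇ (λ x → if b then not b′ ∧ p x else q x) xs)
    ≡ (if b then (if b′ then 0 else length (filterᵇ p xs)) else length (filterᵇ q xs))
length-filterᵇ-if true  true  p q xs = cong length (filterᵇ-false xs)
length-filterᵇ-if true  false p q xs = refl
length-filterᵇ-if false b′    p q xs = refl

indepAvoiding-colourClass-∷ : ∀ {l n} (adj : Fin (suc n) → Fin (suc n) → Bool) →
  (∀ a b → adj a b ≡ adj b a) → (∀ a → adj a a ≡ false) →
  (c d : Fin l) (ψ : Vec (Fin l) n) (B : Fin (suc n) → Bool) →
  indepAvoiding adj (colourClass c (d ∷ ψ)) B (allFin (suc n))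
    ≡ (if d == c
       then not (B zero) ∧ indepAvoiding (adj on suc) (colourClass c ψ) (λ a → B (suc a) ∨ adj zero (suc a)) (allFin n)
       else indepAvoiding (adj on suc) (colourClass c ψ) (B ∘ suc) (allFin n))
indepAvoiding-colourClass-∷ {n = n} adj adj-sym irr c d ψ B = begin
  indepAvoiding adj S B (allFin (suc n))
    ≡⟨ cong (indepAvoiding adj S B) (allFin-suc n) ⟩
  indepAvoiding adj S B (zero ∷ map suc (allFin n))
    ≡⟨ indepAvoiding-∷ adj S B zero (map suc (allFin n)) adj-sym (irr zero) ⟩
  (if d == c then not (B zero) ∧ indepAvoiding adj S (λ a → B a ∨ adj zero a) (map suc (allFin n))
             else indepAvoiding adj S B (map suc (allFin n)))
    ≡⟨ cong₂ (λ s t → if d == c then not (B zero) ∧ s else t)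
             (indepAvoiding-map adj S (λ a → B a ∨ adj zero a) suc (allFin n))
             (indepAvoiding-map adj S B suc (allFin n)) ⟩
  _ ∎
  where
  open ≡-Reasoning
  S : Fin (suc n) → Bool
  S = colourClass c (d ∷ ψ)

count-indepAvoiding : ∀ {l} (c : Fin l) n (adj : Fin n → Fin n → Bool) →
  (∀ a b → adj a b ≡ adj b a) → (∀ a → adj a a ≡ false) → (B : Fin n → Bool) →
  length (filterᵇ (λ ψ → indepAvoiding adj (colourClass c ψ) B (allFin n)) (allMaps l n))
    ≡ indepCount (l ∸ 1) adj (allFin n) B
count-indepAvoiding c zero adj adj-sym irr B = refl
count-indepAvoiding {l} c (suc n) adj adj-sym irr B = begin
  length (filterᵇ p (allMaps l (suc n)))
    ≡⟨ count-allMaps-suc l n p ⟩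
  sum (map (λ d → length (filterᵇ (p ∘ (d ∷_)) (allMaps l n))) (allFin l))
    ≡⟨ cong sum (map-cong first-colour (allFin l)) ⟩
  sum (map (λ d → if d == c then (if B zero then 0 else I₁) else I₀) (allFin l))
    ≡⟨ sum-allFin-indicator c (if B zero then 0 else I₁) I₀ ⟩
  (if B zero then 0 else I₁) + (l ∸ 1) * I₀
    ≡⟨ +-comm (if B zero then 0 else I₁) _ ⟩
  (l ∸ 1) * I₀ + (if B zero then 0 else I₁)
    ≡⟨ indepCount-allFin-suc (l ∸ 1) adj B ⟨
  indepCount (l ∸ 1) adj (allFin (suc n)) B ∎
  where
  open ≡-Reasoning
  p : Vec (Fin l) (suc n) → Bool
  p ψ = indepAvoiding adj (colourClass c ψ) B (allFin (suc n))
  B₁ B₀ : Fin n → Bool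
  B₁ a = B (suc a) ∨ adj zero (suc a)
  B₀ = B ∘ suc
  avoiding : (Fin n → Bool) → Vec (Fin l) n → Bool
  avoiding B′ ψ = indepAvoiding (adj on suc) (colourClass c ψ) B′ (allFin n)
  #avoiding : (Fin n → Bool) → ℕ
  #avoiding B′ = length (filterᵇ (avoiding B′) (allMaps l n))
  I₁ I₀ : ℕ
  I₁ = indepCount (l ∸ 1) (adj on suc) (allFin n) B₁
  I₀ = indepCount (l ∸ 1) (adj on suc) (allFin n) B₀
  count : (B′ : Fin n → Bool) → #avoiding B′ ≡ indepCount (l ∸ 1) (adj on suc) (allFin n) B′
  count = count-indepAvoiding c n (adj on suc) (λ a b → adj-sym (suc a) (suc b)) (irr ∘ suc)
  first-colour : ∀ d → length (filterᵇ (p ∘ (d ∷_)) (allMaps l n)) ≡ (if d == c then (if B zero then 0 else I₁) else I₀)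
  first-colour d = begin
    length (filterᵇ (p ∘ (d ∷_)) (allMaps l n))
      ≡⟨ cong length (filterᵇ-cong (λ ψ → indepAvoiding-colourClass-∷ adj adj-sym irr c d ψ B) (allMaps l n)) ⟩
    length (filterᵇ (λ ψ → if d == c then not (B zero) ∧ avoiding B₁ ψ else avoiding B₀ ψ) (allMaps l n))
      ≡⟨ length-filterᵇ-if (d == c) (B zero) (avoiding B₁) (avoiding B₀) (allMaps l n) ⟩
    (if d == c then (if B zero then 0 else #avoiding B₁) else #avoiding B₀)
      ≡⟨ cong₂ (λ s t → if d == c then (if B zero then 0 else s) else t) (count B₁) (count B₀) ⟩
    (if d == c then (if B zero then 0 else I₁) else I₀) ∎

-- The hypergraph H_{•G}

edgeOK-triple : ∀ {m l} (φ : Fin m → Fin l) (x y z : Fin m) →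
                edgeOK φ (x ∷ y ∷ z ∷ []) ≡ not (φ x == φ z ∧ φ y == φ z)
edgeOK-triple φ x y z
  rewrite ==-refl (φ x) | ==-refl (φ y) | ==-refl (φ z)
        | ==-sym (φ y) (φ x) | ==-sym (φ z) (φ x) | ==-sym (φ z) (φ y)
  with φ x == φ y in xy | φ x == φ z in xz | φ y == φ z in yz
... | true  | true  | true  = refl
... | true  | true  | false = refl
... | true  | false | true  = refl
... | true  | false | false = refl
... | false | true  | true  = -- impossible: φ x = φ z = φ y
  sym (trans (sym xy) (trans (cong₂ _==_ (==-sound xz) (==-sound yz)) (==-refl (φ z))))
... | false | true  | false = refl
... | false | false | true  = refl
... | false | false | false = refl

weakProper-bulletH : ∀ {n l} (G : SimpleGraph n) (c : Fin l) (ψ : Vec (Fin l) n) →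
  weakProper (bulletH G) (lookup (c ∷ ψ)) ≡ independentᵇ (adj G) (colourClass c ψ) (allFin n)
weakProper-bulletH {n} {l} G c ψ =
  trans (all-concatMap (edgeOK φ) triangles (allFin n)) (all-cong triangles-at (allFin n))
  where
  φ : Fin (suc n) → Fin l
  φ = lookup (c ∷ ψ)
  S : Fin n → Bool
  S = colourClass c ψ
  triangles : Fin n → List (List (Fin (suc n)))
  triangles u = map (λ w → suc u ∷ suc w ∷ zero ∷ []) (filterᵇ (adj G u) (allFin n))
  triangles-at : ∀ u → all (edgeOK φ) (triangles u) ≡ all (λ w → not (S u ∧ S w ∧ adj G u w)) (allFin n)
  triangles-at u = begin
    all (edgeOK φ) (triangles u)
      ≡⟨ all-map (edgeOK φ) (λ w → suc u ∷ suc w ∷ zero ∷ []) (filterᵇ (adj G u) (allFin n)) ⟩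
    all (λ w → edgeOK φ (suc u ∷ suc w ∷ zero ∷ [])) (filterᵇ (adj G u) (allFin n))
      ≡⟨ all-filterᵇ _ (adj G u) (allFin n) ⟩
    all (λ w → not (adj G u w) ∨ edgeOK φ (suc u ∷ suc w ∷ zero ∷ [])) (allFin n)
      ≡⟨ all-cong (λ w → trans (cong (not (adj G u w) ∨_) (edgeOK-triple φ (suc u) (suc w) zero))
                               (not-∨-not (adj G u w) (S u) (S w))) (allFin n) ⟩
    all (λ w → not (S u ∧ S w ∧ adj G u w)) (allFin n) ∎
    where open ≡-Reasoning

P-bulletH : ∀ {n} (G : SimpleGraph n) (l : ℕ) →
            P (bulletH G) l ≡ l * indepCount (l ∸ 1) (adj G) (allFin n) (λ _ → false)
P-bulletH {n} G l = begin
  length (filterᵇ proper (allMaps l (suc n)))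
    ≡⟨ count-allMaps-suc l n proper ⟩
  sum (map (λ c → length (filterᵇ (proper ∘ (c ∷_)) (allMaps l n))) (allFin l))
    ≡⟨ cong sum (map-cong apex-coloured (allFin l)) ⟩
  sum (map (λ _ → I) (allFin l))
    ≡⟨ sum-allFin-const I l ⟩
  l * I ∎
  where
  open ≡-Reasoning
  proper : Vec (Fin l) (suc n) → Bool
  proper φ = weakProper (bulletH G) (lookup φ)
  I : ℕ
  I = indepCount (l ∸ 1) (adj G) (allFin n) (λ _ → false)
  apex-coloured : ∀ c → length (filterᵇ (proper ∘ (c ∷_)) (allMaps l n)) ≡ I
  apex-coloured c = begin
    length (filterᵇ (proper ∘ (c ∷_)) (allMaps l n))
      ≡⟨ cong length (filterᵇ-cong (λ ψ → trans (weakProper-bulletH G c ψ)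
                                                 (sym (indepAvoiding-nothing (adj G) (colourClass c ψ) (allFin n))))
                                    (allMaps l n)) ⟩
    length (filterᵇ (λ ψ → indepAvoiding (adj G) (colourClass c ψ) (λ _ → false) (allFin n)) (allMaps l n))
      ≡⟨ count-indepAvoiding c n (adj G) (SimpleGraph.sym G) (irref G) (λ _ → false) ⟩
    I ∎

map-lookupL-allFin : ∀ {n} (ws : List (Fin n)) → map (lookupL ws) (allFin (length ws)) ≡ ws
map-lookupL-allFin [] = refl
map-lookupL-allFin (w ∷ ws) = trans (cong (map (lookupL (w ∷ ws))) (allFin-suc (length ws)))
                                    (cong (w ∷_) (trans (sym (map-∘ (allFin (length ws)))) (map-lookupL-allFin ws)))

P-bulletH-induce : ∀ {n} (G : SimpleGraph n) (ws : List (Fin n)) (l : ℕ) →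
                   P (bulletH (induce G ws)) l ≡ l * indepCount (l ∸ 1) (adj G) ws (λ _ → false)
P-bulletH-induce G ws l = begin
  P (bulletH (induce G ws)) l
    ≡⟨ P-bulletH (induce G ws) l ⟩
  l * indepCount (l ∸ 1) (adj G on lookupL ws) (allFin (length ws)) (λ _ → false)
    ≡⟨ cong (l *_) (indepCount-map (l ∸ 1) (adj G) (lookupL ws) (allFin (length ws)) (λ _ → false)) ⟨
  l * indepCount (l ∸ 1) (adj G) (map (lookupL ws) (allFin (length ws))) (λ _ → false)
    ≡⟨ cong (λ xs → l * indepCount (l ∸ 1) (adj G) xs (λ _ → false)) (map-lookupL-allFin ws) ⟩
  l * indepCount (l ∸ 1) (adj G) ws (λ _ → false) ∎
  where open ≡-Reasoning

-- The vertex recursion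

remaining : ∀ {n} → (Fin n → Bool) → List (Fin n)
remaining {n} S = filterᵇ (λ u → not (S u)) (allFin n)

neighbours-minus-single : ∀ {n} (G : SimpleGraph n) (v : Fin n) →
                          length (filterᵇ (adj G v) (remaining (single v))) ≡ degree G v
neighbours-minus-single {n} G v =
  cong length (trans (filterᵇ-filterᵇ (adj G v) _ (allFin n)) (filterᵇ-cong neighbour-≢ (allFin n)))
  where
  neighbour-≢ : ∀ u → not (u == v) ∧ adj G v u ≡ adj G v u
  neighbour-≢ u with u == v in u==v
  ... | false = refl
  ... | true with refl ← ==-sound u==v = sym (irref G u)

nonNeighbours-minus-single : ∀ {n} (G : SimpleGraph n) (v : Fin n) →
  filterᵇ (not ∘ adj G v) (remaining (single v)) ≡ remaining (closedNbhd G v)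
nonNeighbours-minus-single {n} G v =
  trans (filterᵇ-filterᵇ (not ∘ adj G v) _ (allFin n)) (filterᵇ-cong (λ u → not-∨ (u == v) (adj G v u)) (allFin n))

private
  distrib : ∀ l k p a b → l * (k * a + p * b) ≡ k * (l * a) + p * (l * b)
  distrib = solve-∀

proposition3 : ∀ (n : ℕ) (G : SimpleGraph n) (v : Fin n) (λ′ : ℕ) → 1 ≤ λ′ →
    P (bulletH G) λ′ ≡
      (λ′ ∸ 1) * P (bulletH (G minus single v)) λ′
      + (λ′ ∸ 1) ^ degree G v * P (bulletH (G minus closedNbhd G v)) λ′
proposition3 n G v λ′ _ = begin
  P (bulletH G) λ′
    ≡⟨ P-bulletH G λ′ ⟩
  λ′ * I (allFin n) none
    ≡⟨ cong (λ′ *_) (indepCount-extract k (adj G) (SimpleGraph.sym G) v (allFin n) (length-filterᵇ-== v) none) ⟩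
  λ′ * (k * I V₁ none + I V₁ (adj G v))
    ≡⟨ cong (λ t → λ′ * (k * I V₁ none + t)) (indepCount-blocked k (adj G) V₁ none (adj G v)) ⟩
  λ′ * (k * I V₁ none + k ^ length (filterᵇ (adj G v) V₁) * I (filterᵇ (not ∘ adj G v) V₁) none)
    ≡⟨ cong₂ (λ d W → λ′ * (k * I V₁ none + k ^ d * I W none))
             (neighbours-minus-single G v) (nonNeighbours-minus-single G v) ⟩
  λ′ * (k * I V₁ none + k ^ degree G v * I V₂ none)
    ≡⟨ distrib λ′ k (k ^ degree G v) (I V₁ none) (I V₂ none) ⟩
  k * (λ′ * I V₁ none) + k ^ degree G v * (λ′ * I V₂ none)
    ≡⟨ cong₂ (λ s t → k * s + k ^ degree G v * t) (P-bulletH-induce G V₁ λ′) (P-bulletH-induce G V₂ λ′) ⟨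
  k * P (bulletH (G minus single v)) λ′ + k ^ degree G v * P (bulletH (G minus closedNbhd G v)) λ′ ∎
  where
  open ≡-Reasoning
  k : ℕ
  k = λ′ ∸ 1
  I : List (Fin n) → (Fin n → Bool) → ℕ
  I = indepCount k (adj G)
  none : Fin n → Bool
  none _ = false
  V₁ V₂ : List (Fin n)
  V₁ = remaining (single v)
  V₂ = remaining (closedNbhd G v)
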